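{- Let $\mathbf x = x_1x_2\ldots$ be an infinite word over a finite alphabet. The following are equivalent: (i) $\mathbf x$ is eventually periodic; (ii) $r(n,\mathbf x) \le 2n$ for all sufficiently large integers $n$; (iii) there exists $M$ such that $r(n,\mathbf x) - n \le M$ for all $n \ge 1$.
   Context: $x_i^j$ denotes $x_i\cdots x_j$, and $r(n,\mathbf x) = \min\{ m \ge 1 : x_i^{i+n-1} = x_{m-n+1}^{m} \text{ for some } i \text{ with } 1 \le i \le m-n\}$ (the length of the shortest prefix of $\mathbf x$ containing two possibly overlapping occurrences of some word of length $n$). -}

module Defs where

open import Data.Nat using (ℕ; zero; suc; _+_; _∸_; _≤_; _<_; _*_)
open import Data.Fin using (Fin)
open import Data.Product using (Σ; _×_; ∃; ∃-syntax)
open import Relation.Binary.PropositionalEquality using (_≡_)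
open import Relation.Nullary using (¬_)

-- An infinite word x = x₁x₂… over the finite alphabet Fin k.
-- Convention: the letter x_j (j ≥ 1, 1-based as in the paper) is  x (j ∸ 1),
-- i.e. the Agda function is 0-indexed.
Word : ℕ → Set
Word k = ℕ → Fin k

-- Repeat x n m :  there is i with 1 ≤ i ≤ m - n such that
--   x_i^{i+n-1} = x_{m-n+1}^{m}.
-- In 0-based terms: x_{i+t} = x (i ∸ 1 + t) and x_{m-n+1+t} = x (m ∸ n + t), t < n.
Repeat : ∀ {k} → Word k → ℕ → ℕ → Set
Repeat x n m =
  Σ ℕ λ i → (1 ≤ i) × (i ≤ m ∸ n) ×
    (∀ t → t < n → x (i ∸ 1 + t) ≡ x (m ∸ n + t))

-- IsR x n m  ⟺  m = r(n, x) = min { m ≥ 1 : Repeat x n m }.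
IsR : ∀ {k} → Word k → ℕ → ℕ → Set
IsR x n m = (1 ≤ m) × Repeat x n m × (∀ m′ → 1 ≤ m′ → Repeat x n m′ → m ≤ m′)

EventuallyPeriodic : ∀ {k} → Word k → Set
EventuallyPeriodic x =
  Σ ℕ λ p → (1 ≤ p) × (Σ ℕ λ N → ∀ j → N ≤ j → x (j + p) ≡ x j)

module Submission where

-- A repeat of length n in the prefix of length m is the same as a window [a, m) with a period
-- d ≥ 1 and m = a + d + n, so the argument is about periods of windows.  The file develops
--   * periods of a window: restriction, sums and multiples, congruent positions, and the
--     Fine–Wilf theorem (two periods of a long window yield their gcd), by Euclid's algorithm;
--   * the translation between repeats and periodic windows, and decidability of repeats, which
--     gives the minimum r(n) whenever some repeat exists;
--   * (i) ⇒ (iii): a word with period p from N repeats every length-n factor within N + p + n;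
--   * (iii) ⇒ (i): if r(n) ≤ n + M, then all those periods d ≤ M divide M!, a period of x from M on;
--   * (ii) ⇒ (iii): Fine–Wilf shows r(n + 1) ≤ r(n) + 1 whenever r(n + 1) ≤ 2(n + 1).

open import Defs
open import Data.Nat using (ℕ; _+_; _*_; _≤_)
open import Data.Product using (Σ; _×_)
open import Function.Bundles using (_⇔_)

open import Data.Nat using (zero; suc; _∸_; _<_; _!; z≤n; s≤s; >-nonZero)
open import Data.Nat.Properties
open import Data.Nat.Divisibility
  using (_∣_; divides; ∣⇒≤; ∣-refl; ∣-trans; ∣-antisym; m∣m*n; ∣m+n∣m⇒∣n; ∣m∣n⇒∣m+n; m≤n⇒m!∣n!)
open import Data.Nat.GCD
  using (gcd; gcd[m,n]∣m; gcd[m,n]∣n; gcd-greatest; gcd-comm; gcd-identityˡ; gcd-identityʳ; gcd[m,n]≢0)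
open import Data.Nat.Induction using (<-wellFounded)
open import Data.Nat.Tactic.RingSolver using (solve-∀)
open import Data.Product using (_,_; ∃)
open import Data.Sum using (inj₁; inj₂)
open import Data.Fin.Properties using () renaming (_≟_ to _≟ᶠ_)
open import Function.Bundles using (mk⇔)
open import Induction.WellFounded using (Acc; acc)
open import Relation.Binary.Definitions using (tri<; tri≈; tri>)
open import Relation.Binary.PropositionalEquality
  using (_≡_; refl; sym; trans; cong; subst; subst₂; module ≡-Reasoning)
open import Relation.Nullary using (Dec; yes; no)
open import Relation.Nullary.Decidable using (map′)
open import Relation.Unary using (Decidable)

[a+b]+c≡[a+c]+b : ∀ a b c → a + b + c ≡ a + c + b
[a+b]+c≡[a+c]+b = solve-∀

gcd[m,m]≡m : ∀ m → gcd m m ≡ m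
gcd[m,m]≡m m = ∣-antisym (gcd[m,n]∣m m m) (gcd-greatest ∣-refl ∣-refl)

gcd[m,m+n]≡gcd[m,n] : ∀ m n → gcd m (m + n) ≡ gcd m n
gcd[m,m+n]≡gcd[m,n] m n = ∣-antisym
  (gcd-greatest (gcd[m,n]∣m m (m + n)) (∣m+n∣m⇒∣n (gcd[m,n]∣n m (m + n)) (gcd[m,n]∣m m (m + n))))
  (gcd-greatest (gcd[m,n]∣m m n) (∣m∣n⇒∣m+n (gcd[m,n]∣m m n) (gcd[m,n]∣n m n)))

m<m+n⇒0<n : ∀ {m n} → m < m + n → 0 < n
m<m+n⇒0<n {m} {n} m<m+n = +-cancelˡ-< m 0 n (subst (_< m + n) (sym (+-identityʳ m)) m<m+n)

1≤gcd : ∀ m n → 1 ≤ n → 1 ≤ gcd m n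
1≤gcd m n 1≤n = n≢0⇒n>0 (gcd[m,n]≢0 m n (inj₂ (n>0⇒n≢0 1≤n)))

∣-factorial : ∀ {d M} → 1 ≤ d → d ≤ M → d ∣ M !
∣-factorial {suc d} _ d≤M = ∣-trans (m∣m*n (d !)) (m≤n⇒m!∣n! d≤M)

least : {Q : ℕ → Set} → Decidable Q → ∀ {m} → Q m →
        Σ ℕ λ m₀ → Q m₀ × m₀ ≤ m × (∀ m′ → Q m′ → m₀ ≤ m′)
least {Q} Q? {m} q = search m (<-wellFounded m) q
  where
  search : ∀ m → Acc _<_ m → Q m → Σ ℕ λ m₀ → Q m₀ × m₀ ≤ m × (∀ m′ → Q m′ → m₀ ≤ m′)
  search m (acc below) q with anyUpTo? Q? m
  ... | no none = m , q , ≤-refl , λ m′ q′ → ≮⇒≥ (λ m′<m → none (m′ , m′<m , q′))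
  ... | yes (m′ , m′<m , q′) =
    let (m₀ , q₀ , m₀≤m′ , minimal) = search m′ (below m′<m) q′
    in  m₀ , q₀ , ≤-trans m₀≤m′ (<⇒≤ m′<m) , minimal

module _ {k : ℕ} (x : Word k) where

  Periodic : ℕ → ℕ → ℕ → Set
  Periodic p lo hi = ∀ u → lo ≤ u → u + p < hi → x u ≡ x (u + p)

  periodic-restrict : ∀ {p lo hi lo′ hi′} → lo ≤ lo′ → hi′ ≤ hi → Periodic p lo hi → Periodic p lo′ hi′
  periodic-restrict lo≤lo′ hi′≤hi P u lo′≤u u+p<hi′ = P u (≤-trans lo≤lo′ lo′≤u) (<-≤-trans u+p<hi′ hi′≤hi)

  periodic-+ : ∀ {p q lo hi} → Periodic p lo hi → Periodic q lo hi → Periodic (p + q) lo hi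
  periodic-+ {p} {q} {lo} {hi} Pp Pq u lo≤u u+[p+q]<hi = begin
    x u             ≡⟨ Pp u lo≤u (≤-<-trans (m≤m+n (u + p) q) u+p+q<hi) ⟩
    x (u + p)       ≡⟨ Pq (u + p) (≤-trans lo≤u (m≤m+n u p)) u+p+q<hi ⟩
    x (u + p + q)   ≡⟨ cong x (+-assoc u p q) ⟩
    x (u + (p + q)) ∎
    where
    open ≡-Reasoning
    u+p+q<hi : u + p + q < hi
    u+p+q<hi = subst (_< hi) (sym (+-assoc u p q)) u+[p+q]<hi

  periodic-* : ∀ {p lo hi} K → Periodic p lo hi → Periodic (K * p) lo hi
  periodic-* zero    P u _ _ = cong x (sym (+-identityʳ u))
  periodic-* (suc K) P       = periodic-+ P (periodic-* K P)

  periodic-∣ : ∀ {p q lo hi} → p ∣ q → Periodic p lo hi → Periodic q lo hi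
  periodic-∣ (divides K refl) = periodic-* K

  periodic-congruent-≤ : ∀ {g lo hi d e u v} → Periodic g lo hi → g ∣ d → g ∣ e → u + d ≡ v + e →
                         lo ≤ u → v < hi → u ≤ v → x u ≡ x v
  periodic-congruent-≤ {g} {d = d} {e} {u} P g∣d g∣e u+d≡v+e lo≤u v<hi u≤v with m≤n⇒∃[o]m+o≡n u≤v
  ... | w , refl = periodic-∣ g∣w P u lo≤u v<hi
    where
    d≡e+w : d ≡ e + w
    d≡e+w = +-cancelˡ-≡ u d (e + w) (trans u+d≡v+e (shuffle u w e))
      where
      shuffle : ∀ u w e → u + w + e ≡ u + (e + w)
      shuffle = solve-∀
    g∣w : g ∣ w
    g∣w = ∣m+n∣m⇒∣n (subst (g ∣_) d≡e+w g∣d) g∣e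

  periodic-congruent : ∀ {g lo hi d e u v} → Periodic g lo hi → g ∣ d → g ∣ e → u + d ≡ v + e →
                       lo ≤ u → lo ≤ v → u < hi → v < hi → x u ≡ x v
  periodic-congruent {u = u} {v} P g∣d g∣e u+d≡v+e lo≤u lo≤v u<hi v<hi with ≤-total u v
  ... | inj₁ u≤v = periodic-congruent-≤ P g∣d g∣e u+d≡v+e lo≤u v<hi u≤v
  ... | inj₂ v≤u = sym (periodic-congruent-≤ P g∣e g∣d (sym u+d≡v+e) lo≤v u<hi v≤u)

  periodic-difference : ∀ {p r lo h} → Periodic p lo (p + h) → Periodic (p + r) lo (p + h) → Periodic r lo h
  periodic-difference {p} {r} {lo} {h} Pp Pp+r u lo≤u u+r<h = begin
    x u             ≡⟨ Pp+r u lo≤u (subst (_< p + h) (rotate p u r) p+[u+r]<p+h) ⟩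
    x (u + (p + r)) ≡⟨ cong x (rotate′ u p r) ⟩
    x (u + r + p)   ≡⟨ Pp (u + r) (≤-trans lo≤u (m≤m+n u r)) (subst (_< p + h) (+-comm p (u + r)) p+[u+r]<p+h) ⟨
    x (u + r)       ∎
    where
    open ≡-Reasoning
    p+[u+r]<p+h : p + (u + r) < p + h
    p+[u+r]<p+h = +-monoʳ-< p u+r<h
    rotate : ∀ p u r → p + (u + r) ≡ u + (p + r)
    rotate = solve-∀
    rotate′ : ∀ u p r → u + (p + r) ≡ u + r + p
    rotate′ = solve-∀

  -- A period g of [lo, h) that divides a period p of [lo, p + h) extends to all of [lo, p + h),
  -- provided [lo, h) is at least p long: positions beyond h are reduced by p, and a position u < lo + p
  -- with u + g ≥ h is matched with the position v = u + g - p, which is congruent to u modulo g.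
  periodic-extend : ∀ {g p lo h} → g ∣ p → lo + p ≤ h → Periodic g lo h → Periodic p lo (p + h) →
                    Periodic g lo (p + h)
  periodic-extend {g} {p} {lo} {h} g∣p lo+p≤h Pg Pp u lo≤u u+g<p+h with u + g <? h | lo + p ≤? u
  ... | yes u+g<h | _ = Pg u lo≤u u+g<h
  ... | no u+g≮h | yes lo+p≤u with m≤n⇒∃[o]m+o≡n (≤-trans (m≤n+m p lo) lo+p≤u)
  ...   | w , refl = begin
    x (p + w)     ≡⟨ cong x (+-comm p w) ⟩
    x (w + p)     ≡⟨ Pp w lo≤w (subst (_< p + h) (+-comm p w) (≤-<-trans (m≤m+n (p + w) g) u+g<p+h)) ⟨
    x w           ≡⟨ Pg w lo≤w w+g<h ⟩
    x (w + g)     ≡⟨ Pp (w + g) (≤-trans lo≤w (m≤m+n w g)) w+g+p<p+h ⟩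
    x (w + g + p) ≡⟨ cong x (trans (+-comm (w + g) p) (sym (+-assoc p w g))) ⟩
    x (p + w + g) ∎
    where
    open ≡-Reasoning
    lo≤w : lo ≤ w
    lo≤w = +-cancelˡ-≤ p lo w (subst (_≤ p + w) (+-comm lo p) lo+p≤u)
    w+g<h : w + g < h
    w+g<h = +-cancelˡ-< p (w + g) h (subst (_< p + h) (+-assoc p w g) u+g<p+h)
    w+g+p<p+h : w + g + p < p + h
    w+g+p<p+h = subst (_< p + h) (+-comm p (w + g)) (+-monoʳ-< p w+g<h)
  periodic-extend {g} {p} {lo} {h} g∣p lo+p≤h Pg Pp u lo≤u u+g<p+h | no u+g≮h | no lo+p≰u
    with m≤n⇒∃[o]m+o≡n (≤-trans (m≤n+m p lo) (≤-trans lo+p≤h (≮⇒≥ u+g≮h)))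
  ... | v , p+v≡u+g = begin
    x u       ≡⟨ periodic-congruent Pg ∣-refl g∣p (sym v+p≡u+g) lo≤u lo≤v u<h v<h ⟩
    x v       ≡⟨ Pp v lo≤v (subst (_< p + h) (sym v+p≡u+g) u+g<p+h) ⟩
    x (v + p) ≡⟨ cong x v+p≡u+g ⟩
    x (u + g) ∎
    where
    open ≡-Reasoning
    v+p≡u+g : v + p ≡ u + g
    v+p≡u+g = trans (+-comm v p) p+v≡u+g
    u<h : u < h
    u<h = <-≤-trans (≰⇒> lo+p≰u) lo+p≤h
    lo≤v : lo ≤ v
    lo≤v = +-cancelˡ-≤ p lo v (subst₂ _≤_ (+-comm lo p) (sym p+v≡u+g) (≤-trans lo+p≤h (≮⇒≥ u+g≮h)))
    v<h : v < h
    v<h = +-cancelˡ-< p v h (subst (_< p + h) (sym p+v≡u+g) u+g<p+h)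

  -- The window [lo, p + h) is first shortened to
  -- [lo, h), where p and r are periods, and the resulting period gcd p r is then extended back.
  fine-wilf-step : ∀ {p r lo hi} → 1 ≤ r →
    (∀ {h} → lo + p + r ≤ h + gcd p r → Periodic p lo h → Periodic r lo h → Periodic (gcd p r) lo h) →
    lo + p + (p + r) ≤ hi + gcd p (p + r) → Periodic p lo hi → Periodic (p + r) lo hi →
    Periodic (gcd p (p + r)) lo hi
  fine-wilf-step {p} {r} {lo} {hi} 1≤r shorter long Pp Pp+r =
    subst (λ g → Periodic g lo hi) (sym (gcd[m,m+n]≡gcd[m,n] p r))
      (shorten (subst (λ g → lo + p + (p + r) ≤ hi + g) (gcd[m,m+n]≡gcd[m,n] p r) long) Pp Pp+r)
    where
    g : ℕ
    g = gcd p r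
    g≤r : g ≤ r
    g≤r = ∣⇒≤ {{>-nonZero 1≤r}} (gcd[m,n]∣n p r)
    shorten : ∀ {hi} → lo + p + (p + r) ≤ hi + g → Periodic p lo hi → Periodic (p + r) lo hi → Periodic g lo hi
    shorten {hi} long Pp Pp+r with m≤n⇒∃[o]m+o≡n p≤hi
      where
      p≤hi : p ≤ hi
      p≤hi = ≤-trans (m≤n+m p (lo + p)) (+-cancelʳ-≤ r (lo + p + p) hi
               (≤-trans (≤-reflexive (+-assoc (lo + p) p r)) (≤-trans long (+-monoʳ-≤ hi g≤r))))
    ... | h , refl = periodic-extend (gcd[m,n]∣m p r) lo+p≤h
                       (shorter short (periodic-restrict ≤-refl (m≤n+m h p) Pp) (periodic-difference Pp Pp+r))
                       Pp
      where
      short : lo + p + r ≤ h + g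
      short = +-cancelˡ-≤ p _ _ (subst₂ _≤_ (shuffle lo p r) (+-assoc p h g) long)
        where
        shuffle : ∀ lo p r → lo + p + (p + r) ≡ p + (lo + p + r)
        shuffle = solve-∀
      lo+p≤h : lo + p ≤ h
      lo+p≤h = +-cancelʳ-≤ r (lo + p) h (≤-trans short (+-monoʳ-≤ h g≤r))

  -- The Fine–Wilf theorem on a window: periods p and q of a window of length at least
  -- p + q - gcd p q yield the period gcd p q.  Induction on p + q along Euclid's algorithm.
  fine-wilf : ∀ p q {lo hi} → lo + p + q ≤ hi + gcd p q →
              Periodic p lo hi → Periodic q lo hi → Periodic (gcd p q) lo hi
  fine-wilf p q = bounded (p + q) p q ≤-refl
    where
    -- The recursive call on (p, r) for the pair (p, p + r) needs one unit of fuel less, as p ≥ 1.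
    fuel : ∀ {p r s} → suc p + suc (p + r) ≤ suc s → suc p + r ≤ s
    fuel {p} {r} le = ≤-trans (m≤n+m (suc p + r) p) (≤-pred le)
    bounded : ∀ s p q {lo hi} → p + q ≤ s → lo + p + q ≤ hi + gcd p q →
              Periodic p lo hi → Periodic q lo hi → Periodic (gcd p q) lo hi
    bounded s zero q {lo} {hi} _ _ _ Pq = subst (λ g → Periodic g lo hi) (sym (gcd-identityˡ q)) Pq
    bounded s (suc p) zero {lo} {hi} _ _ Pp _ = subst (λ g → Periodic g lo hi) (sym (gcd-identityʳ (suc p))) Pp
    bounded zero (suc p) (suc q) ()
    bounded (suc s) (suc p) (suc q) {lo} {hi} p+q≤s long Pp Pq with <-cmp p q
    ... | tri≈ _ refl _ = subst (λ g → Periodic g lo hi) (sym (gcd[m,m]≡m (suc p))) Pp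
    ... | tri< p<q _ _ with m≤n⇒∃[o]m+o≡n (<⇒≤ p<q)
    ...   | r , refl = fine-wilf-step (m<m+n⇒0<n p<q) (bounded s (suc p) r (fuel p+q≤s)) long Pp Pq
    bounded (suc s) (suc p) (suc q) {lo} {hi} p+q≤s long Pp Pq | tri> _ _ q<p with m≤n⇒∃[o]m+o≡n (<⇒≤ q<p)
    ...   | r , refl = subst (λ g → Periodic g lo hi) (gcd-comm (suc q) (suc q + r))
                         (fine-wilf-step (m<m+n⇒0<n q<p) (bounded s (suc q) r (fuel q+p≤s)) long′ Pq Pp)
      where
      q+p≤s : suc q + suc (q + r) ≤ suc s
      q+p≤s = subst (_≤ suc s) (+-comm (suc q + r) (suc q)) p+q≤s
      long′ : lo + suc q + (suc q + r) ≤ hi + gcd (suc q) (suc q + r)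
      long′ = subst₂ _≤_ ([a+b]+c≡[a+c]+b lo (suc q + r) (suc q))
                         (cong (hi +_) (gcd-comm (suc q + r) (suc q))) long

  periodic-snoc : ∀ {p lo u} → Periodic p lo (u + p) → x u ≡ x (u + p) → Periodic p lo (suc u + p)
  periodic-snoc {p} {u = u} P xu≡xu+p v lo≤v v+p<1+u+p with m<1+n⇒m<n∨m≡n v+p<1+u+p
  ... | inj₁ v+p<u+p = P v lo≤v v+p<u+p
  ... | inj₂ v+p≡u+p rewrite +-cancelʳ-≡ p v u v+p≡u+p = xu≡xu+p

  repeat⇒periodic : ∀ {n m} → Repeat x n m → Σ ℕ λ a → Σ ℕ λ d → 1 ≤ d × a + d + n ≡ m × Periodic d a m
  repeat⇒periodic {n} {m} (suc a , _ , a<m∸n , agree) with m≤n⇒∃[o]m+o≡n a<m∸n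
  ... | o , 1+a+o≡m∸n = a , suc o , s≤s z≤n , a+d+n≡m , periodic
    where
    open ≡-Reasoning
    a+d≡m∸n : a + suc o ≡ m ∸ n
    a+d≡m∸n = trans (+-suc a o) 1+a+o≡m∸n
    a+d+n≡m : a + suc o + n ≡ m
    a+d+n≡m = trans (cong (_+ n) a+d≡m∸n) (m∸n+n≡m (<⇒≤ n<m))
      where
      n<m : n < m
      n<m = m∸n≢0⇒n<m {m} {n} (n>0⇒n≢0 (≤-trans (s≤s z≤n) a<m∸n))
    periodic : Periodic (suc o) a m
    periodic u a≤u u+d<m with m≤n⇒∃[o]m+o≡n a≤u
    ... | t , refl = begin
      x (a + t)         ≡⟨ agree t t<n ⟩
      x (m ∸ n + t)     ≡⟨ cong (λ s → x (s + t)) a+d≡m∸n ⟨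
      x (a + suc o + t) ≡⟨ cong x ([a+b]+c≡[a+c]+b a (suc o) t) ⟩
      x (a + t + suc o) ∎
      where
      t<n : t < n
      t<n = +-cancelˡ-< (a + suc o) t n
              (subst₂ _<_ ([a+b]+c≡[a+c]+b a t (suc o)) (sym a+d+n≡m) u+d<m)

  periodic⇒repeat : ∀ {n a d} → 1 ≤ d → Periodic d a (a + d + n) → Repeat x n (a + d + n)
  periodic⇒repeat {n} {a} {d} 1≤d P =
    suc a , s≤s z≤n , subst (suc a ≤_) (sym a+d+n∸n≡a+d) a<a+d , agree
    where
    open ≡-Reasoning
    a+d+n∸n≡a+d : a + d + n ∸ n ≡ a + d
    a+d+n∸n≡a+d = m+n∸n≡m (a + d) n
    a<a+d : a < a + d
    a<a+d = m<m+n a 1≤d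
    agree : ∀ t → t < n → x (a + t) ≡ x (a + d + n ∸ n + t)
    agree t t<n = begin
      x (a + t)             ≡⟨ P (a + t) (m≤m+n a t) a+t+d<a+d+n ⟩
      x (a + t + d)         ≡⟨ cong x ([a+b]+c≡[a+c]+b a t d) ⟩
      x (a + d + t)         ≡⟨ cong (λ s → x (s + t)) a+d+n∸n≡a+d ⟨
      x (a + d + n ∸ n + t) ∎
      where
      a+t+d<a+d+n : a + t + d < a + d + n
      a+t+d<a+d+n = subst (_< a + d + n) ([a+b]+c≡[a+c]+b a d t) (+-monoʳ-< (a + d) t<n)

  repeat-positive : ∀ {n m} → Repeat x n m → 1 ≤ m
  repeat-positive {n} {m} (_ , 1≤i , i≤m∸n , _) = ≤-trans 1≤i (≤-trans i≤m∸n (m∸n≤m m n))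

  repeat? : ∀ n m → Dec (Repeat x n m)
  repeat? n m = map′ fromSearch toSearch (anyUpTo? agrees? (m ∸ n))
    where
    Agrees : ℕ → Set
    Agrees j = ∀ t → t < n → x (j + t) ≡ x (m ∸ n + t)
    agrees? : Decidable Agrees
    agrees? j = map′ (λ agree t → agree {t}) (λ agree {t} → agree t)
                     (allUpTo? (λ t → x (j + t) ≟ᶠ x (m ∸ n + t)) n)
    fromSearch : (∃ λ j → j < m ∸ n × Agrees j) → Repeat x n m
    fromSearch (j , j<m∸n , agree) = suc j , s≤s z≤n , j<m∸n , agree
    toSearch : Repeat x n m → ∃ λ j → j < m ∸ n × Agrees j
    toSearch (zero , () , _)
    toSearch (suc j , _ , j<m∸n , agree) = j , j<m∸n , agree

  r-exists : ∀ {n m} → Repeat x n m → Σ ℕ λ r → IsR x n r × r ≤ m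
  r-exists {n} rep with least (repeat? n) rep
  ... | r , rep-r , r≤m , minimal = r , (repeat-positive rep-r , rep-r , λ m′ _ → minimal m′) , r≤m

  common-period : ∀ {n a d a′ d′} → 1 ≤ d′ → a′ + d′ ≤ suc n → a + d ≤ a′ + d′ →
                  Periodic d a (a + d + n) → Periodic d′ a′ (a′ + d′ + suc n) →
                  Periodic (gcd d d′) (a + a′) (a + d + n)
  common-period {n} {a} {d} {a′} {d′} 1≤d′ a′+d′≤1+n a+d≤a′+d′ Pd Pd′ =
    fine-wilf d d′ long (periodic-restrict (m≤m+n a a′) ≤-refl Pd)
                        (periodic-restrict (m≤n+m a′ a) (+-mono-≤ a+d≤a′+d′ (n≤1+n n)) Pd′)
    where
    open ≤-Reasoning
    regroup : ∀ a a′ d d′ → a + a′ + d + d′ ≡ a + d + (a′ + d′)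
    regroup = solve-∀
    g : ℕ
    g = gcd d d′
    long : a + a′ + d + d′ ≤ a + d + n + g
    long = begin
      a + a′ + d + d′   ≡⟨ regroup a a′ d d′ ⟩
      a + d + (a′ + d′) ≤⟨ +-monoʳ-≤ (a + d) a′+d′≤1+n ⟩
      a + d + suc n     ≤⟨ +-monoʳ-≤ (a + d) (subst (suc n ≤_) (+-comm g n) (+-monoˡ-≤ n (1≤gcd d d′ 1≤d′))) ⟩
      a + d + (n + g)   ≡⟨ +-assoc (a + d) n g ⟨
      a + d + n + g     ∎

  -- The heart of (ii) ⇒ (iii): in the situation of common-period with a + d < a′ + d′, the repeat of
  -- length n extends to length n + 1.  The position v = a + d + n - d′ is congruent to a + n modulo
  -- gcd d d′, so x (a + n) ≡ x v, and v lies in the second window, so x v ≡ x (v + d′) = x (a + n + d).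
  repeat-extends : ∀ {n a d a′ d′} → 1 ≤ d → 1 ≤ d′ → a′ + d′ ≤ suc n → a + d < a′ + d′ →
                   Periodic d a (a + d + n) → Periodic d′ a′ (a′ + d′ + suc n) → Periodic d a (a + d + suc n)
  repeat-extends {n} {a} {d} {a′} {d′} 1≤d 1≤d′ a′+d′≤1+n a+d<a′+d′ Pd Pd′ =
    subst (Periodic d a) (shift a n d) (periodic-snoc (subst (Periodic d a) ([a+b]+c≡[a+c]+b a d n) Pd) agree)
    where
    shift : ∀ a n d → suc (a + n + d) ≡ a + d + suc n
    shift = solve-∀
    1+n≤d+n : suc n ≤ d + n
    1+n≤d+n = +-monoˡ-≤ n 1≤d
    a′≤n : a′ ≤ n
    a′≤n = m<1+n⇒m≤n (<-≤-trans (m<m+n a′ 1≤d′) a′+d′≤1+n)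
    agree : x (a + n) ≡ x (a + n + d)
    agree with m≤n⇒∃[o]m+o≡n d′≤a+d+n
      where
      d′≤a+d+n : d′ ≤ a + d + n
      d′≤a+d+n = ≤-trans (m≤n+m d′ a′) (≤-trans (≤-trans a′+d′≤1+n 1+n≤d+n)
                   (subst (d + n ≤_) (sym (+-assoc a d n)) (m≤n+m (d + n) a)))
    ... | v , d′+v≡a+d+n = begin
      x (a + n)     ≡⟨ periodic-congruent Pg (gcd[m,n]∣m d d′) (gcd[m,n]∣n d d′) a+n+d≡v+d′
                         (+-monoʳ-≤ a a′≤n) a+a′≤v (+-monoˡ-< n (m<m+n a 1≤d)) v<a+d+n ⟩
      x v           ≡⟨ Pd′ v (≤-trans (m≤n+m a′ a) a+a′≤v) v+d′<a′+d′+1+n ⟩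
      x (v + d′)    ≡⟨ cong x (trans v+d′≡a+d+n ([a+b]+c≡[a+c]+b a d n)) ⟩
      x (a + n + d) ∎
      where
      open ≡-Reasoning
      v+d′≡a+d+n : v + d′ ≡ a + d + n
      v+d′≡a+d+n = trans (+-comm v d′) d′+v≡a+d+n
      a+n+d≡v+d′ : a + n + d ≡ v + d′
      a+n+d≡v+d′ = trans ([a+b]+c≡[a+c]+b a n d) (sym v+d′≡a+d+n)
      Pg : Periodic (gcd d d′) (a + a′) (a + d + n)
      Pg = common-period 1≤d′ a′+d′≤1+n (<⇒≤ a+d<a′+d′) Pd Pd′
      v+d′<a′+d′+1+n : v + d′ < a′ + d′ + suc n
      v+d′<a′+d′+1+n = subst (_< a′ + d′ + suc n) (sym v+d′≡a+d+n) (+-mono-<-≤ a+d<a′+d′ (n≤1+n n))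
      v<a+d+n : v < a + d + n
      v<a+d+n = subst (v <_) v+d′≡a+d+n (m<m+n v 1≤d′)
      a+a′≤v : a + a′ ≤ v
      a+a′≤v = +-cancelʳ-≤ d′ (a + a′) v
                 (subst₂ _≤_ (sym (+-assoc a a′ d′)) (trans (sym (+-assoc a d n)) (sym v+d′≡a+d+n))
                   (+-monoʳ-≤ a (≤-trans a′+d′≤1+n 1+n≤d+n)))

  -- r(n + 1) ≤ m + 1 for any prefix length m containing a repeat of length n, as soon as r(n + 1) ≤ 2(n + 1):
  -- either the shortest repeat of length n + 1 ends no later, or repeat-extends lengthens the given one.
  r-step : ∀ {n m r} → Repeat x n m → IsR x (suc n) r → r ≤ 2 * suc n → r ≤ suc m
  r-step {n} {m} {r} rep (_ , rep′ , minimal) r≤2[n+1]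
    with repeat⇒periodic {n} {m} rep | repeat⇒periodic {suc n} {r} rep′
  ... | a , d , 1≤d , refl , Pd | a′ , d′ , 1≤d′ , refl , Pd′ =
    subst (a′ + d′ + suc n ≤_) (+-suc (a + d) n) r≤a+d+1+n
    where
    a′+d′≤1+n : a′ + d′ ≤ suc n
    a′+d′≤1+n = +-cancelʳ-≤ (suc n) (a′ + d′) (suc n)
                  (subst (a′ + d′ + suc n ≤_) (cong (suc n +_) (+-identityʳ (suc n))) r≤2[n+1])
    r≤a+d+1+n : a′ + d′ + suc n ≤ a + d + suc n
    r≤a+d+1+n with a + d <? a′ + d′
    ... | yes later = minimal _ (repeat-positive extended) extended
      where
      extended : Repeat x (suc n) (a + d + suc n)
      extended = periodic⇒repeat 1≤d (repeat-extends 1≤d 1≤d′ a′+d′≤1+n later Pd Pd′)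
    ... | no not-later = +-monoˡ-≤ (suc n) (≮⇒≥ not-later)

  -- If r(n) ≤ 2n for all n ≥ N, then r(N + j) ≤ r(N) + j by r-step, so every length n ≥ N
  -- repeats within n + r(N) letters.
  doubling⇒bounded : ∀ N → (∀ n → N ≤ n → Σ ℕ λ m → IsR x n m × m ≤ 2 * n) →
                     Σ ℕ λ M → ∀ n → N ≤ n → Σ ℕ λ m → Repeat x n m × m ≤ n + M
  doubling⇒bounded N r≤2n with r≤2n N ≤-refl
  ... | rN , (_ , repN , _) , _ = rN , bounded
    where
    climb : ∀ j → Σ ℕ λ m → Repeat x (j + N) m × m ≤ j + rN
    climb zero = rN , repN , ≤-refl
    climb (suc j) with climb j | r≤2n (suc j + N) (m≤n+m N (suc j))
    ... | m , rep , m≤j+rN | r , isR@(_ , rep-r , _) , r≤2n′ =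
      r , rep-r , ≤-trans (r-step rep isR r≤2n′) (s≤s m≤j+rN)
    bounded : ∀ n → N ≤ n → Σ ℕ λ m → Repeat x n m × m ≤ n + rN
    bounded n N≤n with m≤n⇒∃[o]m+o≡n N≤n
    ... | j , refl =
      let (m , rep , m≤j+rN) = climb j
      in  m , subst (λ n → Repeat x n m) (+-comm j N) rep , ≤-trans m≤j+rN (+-monoˡ-≤ rN (m≤n+m j N))

  -- If every length n ≥ N repeats within n + M letters, then x has period M! from position M on:
  -- for j ≥ M the repeat of length n = j + M! + N has a period d ≤ M, which divides M!, on a window
  -- containing both j and j + M!.
  bounded⇒eventuallyPeriodic : ∀ N M → (∀ n → N ≤ n → Σ ℕ λ m → Repeat x n m × m ≤ n + M) →
                               EventuallyPeriodic x
  bounded⇒eventuallyPeriodic N M bounded = M ! , 1≤n! M , M , periodic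
    where
    periodic : ∀ j → M ≤ j → x (j + M !) ≡ x j
    periodic j M≤j with bounded (j + M ! + N) (m≤n+m N (j + M !))
    ... | m , rep , m≤n+M with repeat⇒periodic rep
    ... | a , d , 1≤d , refl , Pd =
      sym (periodic-∣ (∣-factorial 1≤d (≤-trans (m≤n+m d a) a+d≤M)) Pd j a≤j j+M!<m)
      where
      n : ℕ
      n = j + M ! + N
      a+d≤M : a + d ≤ M
      a+d≤M = +-cancelʳ-≤ n (a + d) M (subst (a + d + n ≤_) (+-comm n M) m≤n+M)
      a≤j : a ≤ j
      a≤j = ≤-trans (m≤m+n a d) (≤-trans a+d≤M M≤j)
      j+M!<m : j + M ! < a + d + n
      j+M!<m = ≤-<-trans (m≤m+n (j + M !) N) (m<n+m n (≤-trans 1≤d (m≤n+m d a)))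

  eventuallyPeriodic⇒bounded-r : EventuallyPeriodic x → Σ ℕ λ C → ∀ n → Σ ℕ λ r → IsR x n r × r ≤ n + C
  eventuallyPeriodic⇒bounded-r (p , 1≤p , N , period) = N + p , bounded-r
    where
    bounded-r : ∀ n → Σ ℕ λ r → IsR x n r × r ≤ n + (N + p)
    bounded-r n =
      let (r , isR , r≤) = r-exists (periodic⇒repeat {n} 1≤p (λ u N≤u _ → sym (period u N≤u)))
      in  r , isR , subst (r ≤_) (+-comm (N + p) n) r≤

theorem2p3 : ∀ {k : ℕ} (x : Word k) →
    (EventuallyPeriodic x ⇔ (Σ ℕ λ N → ∀ n → N ≤ n → Σ ℕ λ m → IsR x n m × m ≤ 2 * n))
    × (EventuallyPeriodic x ⇔ (Σ ℕ λ M → ∀ n → 1 ≤ n → Σ ℕ λ m → IsR x n m × m ≤ n + M))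
theorem2p3 x = mk⇔ i⇒ii ii⇒i , mk⇔ i⇒iii iii⇒i
  where
  i⇒ii : EventuallyPeriodic x → Σ ℕ λ N → ∀ n → N ≤ n → Σ ℕ λ m → IsR x n m × m ≤ 2 * n
  i⇒ii ep =
    let (C , bounded-r) = eventuallyPeriodic⇒bounded-r x ep
    -- n + C ≤ n + n, which is 2 * n unfolded.
    in  C , λ n C≤n → let (r , isR , r≤n+C) = bounded-r n
                      in  r , isR , ≤-trans r≤n+C (+-monoʳ-≤ n (≤-trans C≤n (m≤m+n n 0)))
  ii⇒i : (Σ ℕ λ N → ∀ n → N ≤ n → Σ ℕ λ m → IsR x n m × m ≤ 2 * n) → EventuallyPeriodic x
  ii⇒i (N , r≤2n) =
    let (M , bounded) = doubling⇒bounded x N r≤2n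
    in  bounded⇒eventuallyPeriodic x N M bounded
  i⇒iii : EventuallyPeriodic x → Σ ℕ λ M → ∀ n → 1 ≤ n → Σ ℕ λ m → IsR x n m × m ≤ n + M
  i⇒iii ep =
    let (C , bounded-r) = eventuallyPeriodic⇒bounded-r x ep
    in  C , λ n _ → bounded-r n
  iii⇒i : (Σ ℕ λ M → ∀ n → 1 ≤ n → Σ ℕ λ m → IsR x n m × m ≤ n + M) → EventuallyPeriodic x
  iii⇒i (M , bounded-r) = bounded⇒eventuallyPeriodic x 1 M λ n 1≤n →
    let (r , (_ , rep , _) , r≤n+M) = bounded-r n 1≤n
    in  r , rep , r≤n+M
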